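{- Let $G$ be a finite graph with threshold weighting $\theta$, $n$ a positive integer, $A$ a join-tree over $G$, $S\subseteq V(G)$, and $\mathcal A\subseteq[n]^{V(A)\setminus S}$. Then for every $T$ with $S\subseteq T\subseteq V(G)$ and every $z\in[n]^T$, \[\chi_{A|T}\big(\rho_{V(A)\setminus T}(\mathcal A,z)\big)\ \le\ \chi_{A|S}(\mathcal A).\]
   Context: Graphs are simple; subgraphs have no isolated vertices. $\Delta_\theta(F)=|V(F)|-\sum_{e\in E(F)}\theta(e)$; a threshold weighting for finite $G$ is $\theta:E(G)\to[0,2]$ with $\Delta_\theta(F)\ge0$ for all $F\subseteq G$ and $\Delta_\theta(G)=0$. For $T\subseteq V(G)$, $F\ominus T$ is the union of the components of $F$ vertex-disjoint from $T$. Join-trees: finite rooted binary trees (non-leaf nodes have two ordered children) whose leaves are labeled by elements of $E(G)\cup\{\bot\}$; $\langle A\rangle$ is the subgraph formed by the edge labels, $V(A)=V(\langle A\rangle)$. $[B,C]$ is the join-tree with root children $B,C$; one-node join-trees are atomic. Relations: $\mu(\mathcal A)=|\mathcal A|/n^{|U|}$ for $\mathcal A\subseteq[n]^U$ ($[n]^\emptyset$ has one element); $x_U$ restricts tuple $x$ to coordinates $U$; $\mathcal B\bowtie\mathcal C=\{z\in[n]^{V\cup W}:z_V\in\mathcal B,z_W\in\mathcal C\}$; for $\mathcal A\subseteq[n]^V$, $z\in[n]^T$: $\rho_{V\setminus T}(\mathcal A,z)=\{x\in[n]^{V\setminus T}:\exists y\in\mathcal A,\ y_{V\setminus T}=x,\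 y_{V\cap T}=z_{V\cap T}\}$. For $F\subseteq G$, $S\subseteq V(G)$: $\mathcal A\subseteq[n]^{V(F)\setminus S}$ is an $F|S$-pathset if $\mu(\rho_{V(F)\setminus T}(\mathcal A,z))\le n^{ -\Delta_\theta(F\ominus T)}$ for all $S\subseteq T\subseteq V(G)$, $z\in[n]^T$. Pathset complexity $\chi_{A|S}(\mathcal A)$ for $\mathcal A\subseteq[n]^{V(A)\setminus S}$: for atomic $A$, the minimum number of $\langle A\rangle|S$-pathsets whose union contains $\mathcal A$; for $A=[B,C]$, the minimum of $\sum_{i=1}^m\max\{\chi_{B|S}(\mathcal B_i),\chi_{C|S}(\mathcal C_i)\}$ over finite families $(\mathcal A_i,\mathcal B_i,\mathcal C_i)_{i\le m}$ of $\langle A\rangle|S$-, $\langle B\rangle|S$-, $\langle C\rangle|S$-pathsets with $\mathcal A_i\subseteq\mathcal B_i\bowtie\mathcal C_i$ and $\mathcal A\subseteq\bigcup_i\mathcal A_i$.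
   Formalization: The threshold weighting θ takes rational values in $[0,2]$. -}

module Defs where

open import Data.Bool using (Bool; true; false; _∧_; _∨_; not; if_then_else_; T)
open import Data.Nat as ℕ using (ℕ; zero; suc; _^_; _⊔_)
open import Data.Fin using (Fin; zero; suc; _≟_)
open import Data.Vec.Functional using (_∷_)
open import Data.Integer using (ℤ; +_; -[1+_])
open import Data.Rational as ℚ using (ℚ; 0ℚ; 1ℚ)
open import Data.Maybe using (Maybe; just; nothing)
open import Data.Product using (Σ; _×_; ∃; _,_)
open import Data.Sum using (_⊎_)
open import Relation.Binary.PropositionalEquality using (_≡_)
open import Relation.Nullary using (¬_; does)

record Graph : Set where
  field
    nV : ℕ
    nE : ℕ
    src : Fin nE → Fin nV
    tgt : Fin nE → Fin nV
    loopless : ∀ e → ¬ (src e ≡ tgt e)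
    noParallel : ∀ e e′ →
      ((src e ≡ src e′) × (tgt e ≡ tgt e′)) ⊎ ((src e ≡ tgt e′) × (tgt e ≡ src e′)) →
      e ≡ e′
open Graph public

anyF : ∀ {k} → (Fin k → Bool) → Bool
anyF {zero} f = false
anyF {suc k} f = f zero ∨ anyF (λ i → f (suc i))

sumN : ∀ {k} → (Fin k → ℕ) → ℕ
sumN {zero} f = 0
sumN {suc k} f = f zero ℕ.+ sumN (λ i → f (suc i))

countF : ∀ {k} → (Fin k → Bool) → ℕ
countF f = sumN (λ i → if f i then 1 else 0)

sumQ : ∀ {k} → (Fin k → ℚ) → ℚ
sumQ {zero} f = 0ℚ
sumQ {suc k} f = f zero ℚ.+ sumQ (λ i → f (suc i))

eqb : ∀ {k} → Fin k → Fin k → Bool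
eqb i j = does (i ≟ j)

iter : {A : Set} → ℕ → (A → A) → A → A
iter zero f a = a
iter (suc m) f a = f (iter m f a)

fromℕQ : ℕ → ℚ
fromℕQ m = (+ m) ℚ./ 1

-- Vertex sets and edge sets (a subgraph without isolated vertices is
-- determined by its edge set).

VSet : Graph → Set
VSet G = Fin (nV G) → Bool

ESet : Graph → Set
ESet G = Fin (nE G) → Bool

⊆V : (G : Graph) → VSet G → VSet G → Set
⊆V G S S′ = ∀ v → T (S v) → T (S′ v)

∖V : (G : Graph) → VSet G → VSet G → VSet G
∖V G U S v = U v ∧ not (S v)

incident : (G : Graph) → Fin (nE G) → Fin (nV G) → Bool
incident G e v = eqb (src G e) v ∨ eqb (tgt G e) v

verts : (G : Graph) → ESet G → VSet G
verts G F v = anyF (λ e → F e ∧ incident G e v)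

adjE : (G : Graph) → Fin (nE G) → Fin (nE G) → Bool
adjE G e e′ = incident G e (src G e′) ∨ incident G e (tgt G e′)

growStep : (G : Graph) → ESet G → ESet G → ESet G
growStep G F R e′ = F e′ ∧ (R e′ ∨ anyF (λ e″ → R e″ ∧ adjE G e″ e′))

-- the edge set of the component of F containing edge e (empty if e ∉ F);
-- nE iterations suffice since connecting paths have at most nE edges.
component : (G : Graph) → ESet G → Fin (nE G) → ESet G
component G F e = iter (nE G) (growStep G F) (λ e′ → F e′ ∧ eqb e e′)

⊖ : (G : Graph) → ESet G → VSet G → ESet G
⊖ G F S e =
  F e ∧ not (anyF (λ e′ → component G F e e′ ∧ (S (src G e′) ∨ S (tgt G e′))))

Δθ : (G : Graph) → (Fin (nE G) → ℚ) → ESet G → ℚ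
Δθ G θ F = fromℕQ (countF (verts G F)) ℚ.- sumQ (λ e → if F e then θ e else 0ℚ)

record IsThresholdWeighting (G : Graph) (θ : Fin (nE G) → ℚ) : Set where
  field
    θ-nonneg : ∀ e → 0ℚ ℚ.≤ θ e
    θ-le2    : ∀ e → θ e ℚ.≤ fromℕQ 2
    Δ-nonneg : ∀ (F : ESet G) → 0ℚ ℚ.≤ Δθ G θ F
    Δ-G      : fromℕQ (nV G) ℚ.- sumQ θ ≡ 0ℚ

-- A relation 𝒜 ⊆ [n]^U (U ⊆ V(G)) is encoded by its cylinder
-- 𝒜 × [n]^{V(G)∖U} ⊆ [n]^{V(G)}: a Bool-valued predicate on full tuples
-- depending only on the coordinates in U.  μ is preserved by this encoding.

Tup : Graph → ℕ → Set
Tup G n = Fin (nV G) → Fin n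

Relation : Graph → ℕ → Set
Relation G n = Tup G n → Bool

DependsOn : (G : Graph) (n : ℕ) → VSet G → Relation G n → Set
DependsOn G n U P = ∀ x y → (∀ v → T (U v) → x v ≡ y v) → P x ≡ P y

countAll : (k n : ℕ) → ((Fin k → Fin n) → Bool) → ℕ
countAll zero n P = if P (λ ()) then 1 else 0
countAll (suc k) n P = sumN (λ (a : Fin n) → countAll k n (λ x → P (a ∷ x)))

override : (G : Graph) (n : ℕ) → VSet G → Tup G n → Tup G n → Tup G n
override G n S z x v = if S v then z v else x v

-- ρ_{V∖T}(𝒜, z) (as a cylinder): x ↦ 𝒜(x[T := z])
ρ : (G : Graph) (n : ℕ) → VSet G → Tup G n → Relation G n → Relation G n
ρ G n S z 𝒜 x = 𝒜 (override G n S z x)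

-- "c / n^N ≤ n^(-Δ)" for rational Δ = p/q (q > 0), i.e. (c/n^N)^q ≤ n^(-p)
MeasBound : (n N c : ℕ) → ℚ → Set
MeasBound n N c Δ with ℚ.numerator Δ
... | + p      = (c ^ q) ℕ.* (n ^ p) ℕ.≤ n ^ (N ℕ.* q)
  where q = ℚ.denominatorℕ Δ
... | -[1+ p ] = c ^ q ℕ.≤ n ^ ((N ℕ.* q) ℕ.+ suc p)
  where q = ℚ.denominatorℕ Δ

-- μ(𝒜) ≤ n^(-Δ), with μ computed in [n]^{V(G)} (equal to μ in [n]^U)
μ≤ : (G : Graph) (n : ℕ) → Relation G n → ℚ → Set
μ≤ G n 𝒜 Δ = MeasBound n (nV G) (countAll (nV G) n 𝒜) Δ

IsPathset : (G : Graph) (θ : Fin (nE G) → ℚ) (n : ℕ) → ESet G → VSet G → Relation G n → Set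
IsPathset G θ n F S 𝒜 =
  DependsOn G n (∖V G (verts G F) S) 𝒜 ×
  (∀ (S′ : VSet G) → ⊆V G S S′ → ∀ (z : Tup G n) →
     μ≤ G n (ρ G n S′ z 𝒜) (Δθ G θ (⊖ G F S′)))

-- Join-trees (leaf labels: just e for an edge, nothing for ⊥)

data JoinTree (G : Graph) : Set where
  leaf : Maybe (Fin (nE G)) → JoinTree G
  node : JoinTree G → JoinTree G → JoinTree G

edgesJ : (G : Graph) → JoinTree G → ESet G
edgesJ G (leaf (just e)) e′ = eqb e e′
edgesJ G (leaf nothing) e′ = false
edgesJ G (node B C) e′ = edgesJ G B e′ ∨ edgesJ G C e′

vertsJ : (G : Graph) → JoinTree G → VSet G
vertsJ G A = verts G (edgesJ G A)

⊆R : (G : Graph) (n : ℕ) → Relation G n → Relation G n → Set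
⊆R G n P Q = ∀ x → T (P x) → T (Q x)

Covers : (G : Graph) (n : ℕ) {m : ℕ} → (Fin m → Relation G n) → Relation G n → Set
Covers G n Ps 𝒜 = ∀ x → T (𝒜 x) → ∃ λ i → T (Ps i x)

-- χ≤ G θ n A S 𝒜 k  ⇔  χ_{A|S}(𝒜) ≤ k   (χ is a minimum over a set of
-- naturals; "min ≤ k" means some admissible choice has value ≤ k).
χ≤ : (G : Graph) (θ : Fin (nE G) → ℚ) (n : ℕ) → JoinTree G → VSet G → Relation G n → ℕ → Set
χ≤ G θ n (leaf l) S 𝒜 k =
  Σ ℕ λ m → (m ℕ.≤ k) × Σ (Fin m → Relation G n) λ Ps →
    (∀ i → IsPathset G θ n (edgesJ G (leaf l)) S (Ps i)) × Covers G n Ps 𝒜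
χ≤ G θ n (node B C) S 𝒜 k =
  Σ ℕ λ m →
  Σ (Fin m → Relation G n) λ As →
  Σ (Fin m → Relation G n) λ Bs →
  Σ (Fin m → Relation G n) λ Cs →
  Σ (Fin m → ℕ) λ bs →
  Σ (Fin m → ℕ) λ cs →
    (∀ i → IsPathset G θ n (edgesJ G (node B C)) S (As i)
         × IsPathset G θ n (edgesJ G B) S (Bs i)
         × IsPathset G θ n (edgesJ G C) S (Cs i)
         × ⊆R G n (As i) (λ x → Bs i x ∧ Cs i x)
         × χ≤ G θ n B S (Bs i) (bs i)
         × χ≤ G θ n C S (Cs i) (cs i))
    × (sumN (λ i → bs i ⊔ cs i) ℕ.≤ k)
    × Covers G n As 𝒜

-- Restricting to z on T commutes with everything χ is built from: ρ of a
-- pathset relative to S is a pathset relative to any T ⊇ S (restricting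
-- twice is one restriction to a larger set), ρ preserves inclusions and
-- covers, and ρ distributes over the join.  So ρ applied to every relation
-- of a witness for χ_{A|S}(𝒜) ≤ k is a witness for χ_{A|T}(ρ(𝒜, z)) ≤ k.
module Submission where

open import Defs
open import Data.Nat using (ℕ; zero; suc; _+_; _≤_)
open import Data.Fin as Fin using (Fin)
open import Data.Rational using (ℚ)
open import Data.Bool using (Bool; true; false; T; _∧_; if_then_else_)
open import Data.Bool.Properties using (T-∧; T-not-≡)
open import Data.Empty using (⊥-elim)
open import Data.Product using (_×_; _,_)
open import Data.Unit using (tt)
open import Data.Vec.Functional using (_∷_)
open import Function using (_∘_)
open import Function.Bundles using (Equivalence)
open import Relation.Binary.PropositionalEquality

sumN-cong : ∀ {k} {f g : Fin k → ℕ} → f ≗ g → sumN f ≡ sumN g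
sumN-cong {zero}  f≗g = refl
sumN-cong {suc k} f≗g = cong₂ _+_ (f≗g Fin.zero) (sumN-cong (f≗g ∘ Fin.suc))

countAll-cong : ∀ k n {P Q : (Fin k → Fin n) → Bool} → P ≗ Q → countAll k n P ≡ countAll k n Q
countAll-cong zero    n P≗Q = cong (λ b → if b then 1 else 0) (P≗Q (λ ()))
countAll-cong (suc k) n P≗Q = sumN-cong (λ a → countAll-cong k n (λ x → P≗Q (a ∷ x)))

module _ {G : Graph} {n : ℕ} where

  dependsOn-respects-≗ : ∀ {U P} → DependsOn G n U P → ∀ {x y} → x ≗ y → P x ≡ P y
  dependsOn-respects-≗ dep x≗y = dep _ _ (λ v _ → x≗y v)

  dependsOn-mono : ∀ {U U′ P} → ⊆V G U U′ → DependsOn G n U P → DependsOn G n U′ P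
  dependsOn-mono U⊆U′ dep x y agree = dep x y (λ v → agree v ∘ U⊆U′ v)

  override-override : ∀ {S S′} → ⊆V G S S′ → ∀ (z z′ x : Tup G n) →
    override G n S z (override G n S′ z′ x) ≗ override G n S′ (override G n S z z′) x
  override-override {S} {S′} S⊆S′ z z′ x v with S v in Sv | S′ v in S′v
  ... | true  | true  = refl
  ... | true  | false = ⊥-elim (subst T S′v (S⊆S′ v (subst T (sym Sv) tt)))
  ... | false | _     = refl

  ρ-dependsOn : ∀ {U S P} (z : Tup G n) → DependsOn G n U P → DependsOn G n (∖V G U S) (ρ G n S z P)
  ρ-dependsOn {U} {S} z dep x y agree = dep _ _ agreeOverridden
    where
    agreeOverridden : ∀ v → T (U v) → override G n S z x v ≡ override G n S z y v
    agreeOverridden v v∈U with S v in Sv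
    ... | true  = refl
    ... | false = agree v (Equivalence.from T-∧ (v∈U , Equivalence.from T-not-≡ Sv))

  ρ-ρ : ∀ {U S S′ P} → DependsOn G n U P → ⊆V G S S′ → (z z′ : Tup G n) →
    ρ G n S′ z′ (ρ G n S z P) ≗ ρ G n S′ (override G n S z z′) P
  ρ-ρ dep S⊆S′ z z′ x = dependsOn-respects-≗ dep (override-override S⊆S′ z z′ x)

  ρ-⊆R : ∀ {P Q} S (z : Tup G n) → ⊆R G n P Q → ⊆R G n (ρ G n S z P) (ρ G n S z Q)
  ρ-⊆R S z P⊆Q = P⊆Q ∘ override G n S z

  ρ-covers : ∀ {m} {Ps : Fin m → Relation G n} {𝒜} S (z : Tup G n) →
    Covers G n Ps 𝒜 → Covers G n (ρ G n S z ∘ Ps) (ρ G n S z 𝒜)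
  ρ-covers S z cover = cover ∘ override G n S z

  module _ (θ : Fin (nE G) → ℚ) where

    -- Every restriction of ρ(P, z) to S″ ⊇ S′ is a restriction of P to S″ itself.
    ρ-isPathset : ∀ {F S S′ P} → ⊆V G S S′ → (z : Tup G n) →
      IsPathset G θ n F S P → IsPathset G θ n F S′ (ρ G n S′ z P)
    ρ-isPathset {F} {S} {S′} {P} S⊆S′ z (dep , bound) =
      dependsOn-mono forgetS (ρ-dependsOn z dep) , bound′
      where
      forgetS : ⊆V G (∖V G (∖V G (verts G F) S) S′) (∖V G (verts G F) S′)
      forgetS v v∈ with verts G F v | S v | S′ v
      ... | true | false | false = tt
      bound′ : ∀ S″ → ⊆V G S′ S″ → ∀ z′ → μ≤ G n (ρ G n S″ z′ (ρ G n S′ z P)) (Δθ G θ (⊖ G F S″))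
      bound′ S″ S′⊆S″ z′ =
        subst (λ c → MeasBound n (nV G) c (Δθ G θ (⊖ G F S″)))
          (sym (countAll-cong (nV G) n (ρ-ρ dep S′⊆S″ z z′)))
          (bound S″ (λ v → S′⊆S″ v ∘ S⊆S′ v) (override G n S′ z z′))

    χ≤-ρ : ∀ (A : JoinTree G) {S S′ 𝒜 k} → ⊆V G S S′ → (z : Tup G n) →
      χ≤ G θ n A S 𝒜 k → χ≤ G θ n A S′ (ρ G n S′ z 𝒜) k
    χ≤-ρ (leaf l) {S′ = S′} S⊆S′ z (m , m≤k , Ps , pathsets , cover) =
      m , m≤k , ρ G n S′ z ∘ Ps , ρ-isPathset S⊆S′ z ∘ pathsets , ρ-covers S′ z cover
    χ≤-ρ (node B C) {S} {S′} S⊆S′ z (m , As , Bs , Cs , bs , cs , parts , cost , cover) =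
      m , ρ′ ∘ As , ρ′ ∘ Bs , ρ′ ∘ Cs , bs , cs , restrictPart ∘ parts , cost , ρ-covers S′ z cover
      where
      ρ′ : Relation G n → Relation G n
      ρ′ = ρ G n S′ z
      restrictPart : ∀ {𝒜 ℬ 𝒞 b c} →
        IsPathset G θ n (edgesJ G (node B C)) S 𝒜 × IsPathset G θ n (edgesJ G B) S ℬ ×
        IsPathset G θ n (edgesJ G C) S 𝒞 × ⊆R G n 𝒜 (λ x → ℬ x ∧ 𝒞 x) ×
        χ≤ G θ n B S ℬ b × χ≤ G θ n C S 𝒞 c →
        IsPathset G θ n (edgesJ G (node B C)) S′ (ρ′ 𝒜) × IsPathset G θ n (edgesJ G B) S′ (ρ′ ℬ) ×
        IsPathset G θ n (edgesJ G C) S′ (ρ′ 𝒞) × ⊆R G n (ρ′ 𝒜) (λ x → ρ′ ℬ x ∧ ρ′ 𝒞 x) ×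
        χ≤ G θ n B S′ (ρ′ ℬ) b × χ≤ G θ n C S′ (ρ′ 𝒞) c
      restrictPart (isA , isB , isC , A⊆B⋈C , χB , χC) =
        ρ-isPathset S⊆S′ z isA , ρ-isPathset S⊆S′ z isB , ρ-isPathset S⊆S′ z isC ,
        ρ-⊆R S′ z A⊆B⋈C , χ≤-ρ B S⊆S′ z χB , χ≤-ρ C S⊆S′ z χC

lemma5p9 : (G : Graph) (θ : Fin (nE G) → ℚ) → IsThresholdWeighting G θ →
    (n : ℕ) → 1 ≤ n →
    (A : JoinTree G) (S : VSet G) (𝒜 : Relation G n) →
    DependsOn G n (∖V G (vertsJ G A) S) 𝒜 →
    (S′ : VSet G) → ⊆V G S S′ → (z : Tup G n) →
    (k : ℕ) → χ≤ G θ n A S 𝒜 k → χ≤ G θ n A S′ (ρ G n S′ z 𝒜) k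
lemma5p9 G θ _ n _ A S 𝒜 _ S′ S⊆S′ z k = χ≤-ρ θ A S⊆S′ z
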